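{- Let $(\Sigma,<)$ be a finite totally ordered alphabet and $w\in\Sigma^+$. If $(m_1,\ldots,m_k)$ is a grouping of $\mathrm{CFL}_{in}(w)$, then $\mathrm{CFL}_{in}(w)=(\mathcal{NB}(m_1),\ldots,\mathcal{NB}(m_k))$, the concatenation of the sequences $\mathcal{NB}(m_1),\ldots,\mathcal{NB}(m_k)$.
   Context: Lexicographic order $\prec$ on $\Sigma^*$: $x\prec y$ if $x$ is a proper prefix of $y$, or $x=ras$, $y=rbt$ with $a,b\in\Sigma$, $a<b$. For nonempty $x,y$, $x\ll y$ means $x\prec y$ and $x$ not a proper prefix of $y$; $x\ge_p y$ means $y$ is a prefix of $x$. An inverse Lyndon word is a $u\in\Sigma^+$ with $s\prec u$ for each nonempty proper suffix $s$ of $u$. Inverse order $<_{in}$: $b<_{in}a\iff a<b$; $\prec_{in}$ the induced lexicographic order. An anti-Lyndon word is a nonempty primitive word strictly smaller for $\prec_{in}$ than all its other conjugates. $\mathrm{CFL}_{in}(w)$ is the unique sequence $(\ell_1,\ldots,\ell_h)$ of anti-Lyndon words with $w=\ell_1\cdots\ell_h$ and $\ell_1\succeq_{in}\cdots\succeq_{in}\ell_h$. A PMC in $\mathrm{CFL}_{in}(w)$ is a block $\ell_r,\ldots,\ell_t$ of consecutive factors ($r\le t$) with $\ell_r\ge_p\cdots\ge_p\ell_t$, such that $\ell_r$ is not a prefix of $\ell_{r-1}$ if $r>1$ and $\ell_{t+1}$ is not a prefix of $\ell_t$ if $t<h$. A grouping of a sequence $(\lambda_1,\ldots,\lambda_n)$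 of anti-Lyndon words with $\lambda_i$ a prefix of $\lambda_{i-1}$ is a sequence $(m_1,\ldots,m_q)$ of inverse Lyndon words with $m_j=\lambda_{i_{j-1}+1}\cdots\lambda_{i_j}$ for indices $0=i_0<\cdots<i_q=n$ and $m_1\ll\cdots\ll m_q$. A grouping of $\mathrm{CFL}_{in}(w)$ is obtained by replacing each PMC of $\mathrm{CFL}_{in}(w)$ by a grouping of it. A border of a nonempty word $x$ is a proper prefix of $x$ that is also a suffix; $x$ is bordered if it has a nonempty border, unbordered otherwise; every bordered word has exactly one nonempty unbordered border. $\mathcal{NB}(x)=(x)$ if $x$ is unbordered; otherwise $\mathcal{NB}(x)=(\mathcal{NB}(y),z)$ where $z$ is the unique nonempty unbordered border of $x$ and $x=yz$. -}

module Defs where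

open import Data.Nat using (ℕ; _≥_)
open import Data.Fin using (Fin) renaming (_<_ to _<F_)
open import Data.List using (List; []; _∷_; _++_; concat; map; replicate)
open import Data.List.NonEmpty using (List⁺; head; last; toList)
open import Data.List.Relation.Unary.All using (All)
open import Data.List.Relation.Unary.Linked using (Linked)
open import Data.List.Relation.Binary.Pointwise using (Pointwise)
open import Data.Product using (Σ; ∃; _×_; _,_)
open import Data.Sum using (_⊎_)
open import Relation.Binary.PropositionalEquality using (_≡_; _≢_)
open import Relation.Nullary using (¬_)

-- The finite totally ordered alphabet (Σ,<) is Fin n with its usual order.
Word : ℕ → Set
Word n = List (Fin n)

module _ {n : ℕ} where

  IsPrefix : Word n → Word n → Set
  IsPrefix x y = ∃ λ t → y ≡ x ++ t

  ProperPrefix : Word n → Word n → Set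
  ProperPrefix x y = ∃ λ t → t ≢ [] × y ≡ x ++ t

  ProperSuffix : Word n → Word n → Set
  ProperSuffix s u = ∃ λ v → v ≢ [] × u ≡ v ++ s

  Lex : (Fin n → Fin n → Set) → Word n → Word n → Set
  Lex R x y =
    ProperPrefix x y ⊎
    (Σ (Word n) λ r → Σ (Fin n) λ a → Σ (Word n) λ s → Σ (Fin n) λ b → Σ (Word n) λ t →
       x ≡ r ++ (a ∷ s) × y ≡ r ++ (b ∷ t) × R a b)

  _≺_ : Word n → Word n → Set
  _≺_ = Lex _<F_

  _<in_ : Fin n → Fin n → Set
  b <in a = a <F b

  _≺in_ : Word n → Word n → Set
  _≺in_ = Lex _<in_

  _≽in_ : Word n → Word n → Set
  x ≽in y = y ≺in x ⊎ y ≡ x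

  _≪_ : Word n → Word n → Set
  x ≪ y = x ≺ y × ¬ ProperPrefix x y

  _≥p_ : Word n → Word n → Set
  x ≥p y = IsPrefix y x

  InverseLyndon : Word n → Set
  InverseLyndon u = u ≢ [] × (∀ s → s ≢ [] → ProperSuffix s u → s ≺ u)

  Primitive : Word n → Set
  Primitive w = ¬ (Σ (Word n) λ x → Σ ℕ λ k → k ≥ 2 × w ≡ concat (replicate k x))

  AntiLyndon : Word n → Set
  AntiLyndon w = w ≢ [] × Primitive w ×
    (∀ x y → w ≡ x ++ y → y ++ x ≢ w → w ≺in (y ++ x))

  IsCFLin : Word n → List (Word n) → Set
  IsCFLin w ℓs = All AntiLyndon ℓs × concat ℓs ≡ w × Linked _≽in_ ℓs

  -- Decomposition of a sequence into its PMCs: consecutive blocks, each a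
  -- ≥p-chain, with the first factor of a block not a prefix of the last
  -- factor of the preceding block (maximality).
  IsPMCDecomposition : List (Word n) → List (List⁺ (Word n)) → Set
  IsPMCDecomposition ℓs bs =
    ℓs ≡ concat (map toList bs) ×
    All (λ b → Linked _≥p_ (toList b)) bs ×
    Linked (λ b b' → ¬ IsPrefix (head b') (last b)) bs

  IsGroupingOf : List (Word n) → List (Word n) → Set
  IsGroupingOf λs ms = Σ (List (List (Word n))) λ gs →
    All (λ g → g ≢ []) gs × concat gs ≡ λs × ms ≡ map concat gs ×
    All InverseLyndon ms × Linked _≪_ ms

  IsGroupingCFL : List (Word n) → List (Word n) → Set
  IsGroupingCFL ℓs ms = Σ (List (List⁺ (Word n))) λ bs →
    IsPMCDecomposition ℓs bs × Σ (List (List (Word n))) λ mss →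
    Pointwise IsGroupingOf (map toList bs) mss × ms ≡ concat mss

  Border : Word n → Word n → Set
  Border z x = ProperPrefix z x × (∃ λ v → x ≡ v ++ z)

  Bordered : Word n → Set
  Bordered x = ∃ λ z → z ≢ [] × Border z x

  Unbordered : Word n → Set
  Unbordered x = ¬ Bordered x

  -- NB x ys : ys = 𝒩ℬ(x)  (graph of the recursively defined function)
  data NB : Word n → List (Word n) → Set where
    nb-unb : ∀ {x} → x ≢ [] → Unbordered x → NB x (x ∷ [])
    nb-bor : ∀ {x y z ys} → x ≢ [] → z ≢ [] → Border z x → Unbordered z →
             x ≡ y ++ z → NB y ys → NB x (ys ++ (z ∷ []))

{-# OPTIONS --safe #-}
-- An anti-Lyndon word w is unbordered. If z were a border, w = zt = vz with |t| = |v|; compare w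
-- with its conjugates zv and tz. If zv = w then z and v commute, so they are powers of a common
-- word and w is not primitive. Otherwise minimality of w gives zt ≺in zv and vz ≺in tz, that is
-- t ≺in v and v ≼in t, which is absurd.
--
-- In a PMC every factor of a group m = λ₁⋯λₖ is a prefix of λ₁, hence of λ₁⋯λₖ₋₁; so λₖ is an
-- unbordered border of m and 𝒩ℬ peels off λₖ, …, λ₂ in turn.
module Submission where

open import Defs
open import Data.Nat using (ℕ; zero; suc; _+_; _≤_; _<_; s≤s; z≤n; z<s)
open import Data.Nat.Induction using (<-wellFounded; Acc; acc)
open import Data.Nat.Properties using (suc-injective; +-comm; +-cancelˡ-≡; +-mono-≤; m≤n+m; m<m+n)
open import Data.Fin using (Fin)
open import Data.Fin.Properties using (<-asym) renaming (_≟_ to _≟F_)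
open import Data.List using (List; []; _∷_; _++_; concat; map; replicate; length; [_])
open import Data.List.Properties
  using ( ∷-injectiveˡ; ∷-injectiveʳ; ++-assoc; ++-identityʳ; ++-cancelˡ; ++-cancelʳ; ++-conicalʳ
        ; concat-++; length-++; ≡-dec)
open import Data.List.Relation.Unary.All as All using (All; []; _∷_)
import Data.List.Relation.Unary.All.Properties as All
open import Data.List.Relation.Unary.Linked using (Linked; []; [-]; _∷_)
open import Data.List.Relation.Unary.Linked.Properties using (Linked⇒All)
open import Data.List.Relation.Binary.Pointwise as Pointwise using (Pointwise; []; _∷_)
open import Data.Product as Product using (∃; ∃₂; _×_; _,_; proj₁; proj₂)
open import Data.Sum as Sum using (_⊎_; inj₁; inj₂)
open import Data.Empty using (⊥-elim)
open import Level using (Level)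
open import Relation.Binary.Core using (Rel)
open import Relation.Binary.Definitions using (Asymmetric)
open import Relation.Binary.PropositionalEquality
  using (_≡_; _≢_; refl; sym; trans; cong; subst; subst₂; module ≡-Reasoning)
open import Relation.Nullary using (¬_; yes; no)
open import Function using (_∘_)

private
  variable
    ℓ : Level
    A : Set ℓ
    n : ℕ
    R : Fin n → Fin n → Set
    a b c : Fin n
    t u v x y z : Word n
    ys zs : List (Word n)
    gs lss mss : List (List (Word n))

Linked-++⁻ : ∀ {_∼_ : Rel A ℓ} (xs : List A) {ys : List A} →
             Linked _∼_ (xs ++ ys) → Linked _∼_ xs × Linked _∼_ ys
Linked-++⁻ []           chain         = [] , chain
Linked-++⁻ (x ∷ [])     [-]           = [-] , []
Linked-++⁻ (x ∷ [])     (_ ∷ chain)   = [-] , chain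
Linked-++⁻ (x ∷ y ∷ xs) (x∼y ∷ chain) = Product.map₁ (x∼y ∷_) (Linked-++⁻ (y ∷ xs) chain)

length-<-++∷ : ∀ (xs : List A) {c} ys → length xs < length (xs ++ c ∷ ys)
length-<-++∷ xs ys = subst (length xs <_) (sym (length-++ xs)) (m<m+n (length xs) z<s)

length-<-∷++ : ∀ (c : A) xs ys → length ys < length (c ∷ xs ++ ys)
length-<-∷++ c xs ys = s≤s (subst (length ys ≤_) (sym (length-++ xs)) (m≤n+m (length ys) (length xs)))

Lex-∷⁺ : Lex R x y → Lex R (c ∷ x) (c ∷ y)
Lex-∷⁺         (inj₁ (t , t≢[] , refl))                      = inj₁ (t , t≢[] , refl)
Lex-∷⁺ {c = c} (inj₂ (r , a , s , b , t , refl , refl , aRb)) =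
  inj₂ (c ∷ r , a , s , b , t , refl , refl , aRb)

Lex-∷⁻ : Lex R (a ∷ x) (b ∷ y) → R a b ⊎ (a ≡ b × Lex R x y)
Lex-∷⁻ (inj₁ (t , t≢[] , refl))                          = inj₂ (refl , inj₁ (t , t≢[] , refl))
Lex-∷⁻ (inj₂ ([]    , _ , _ , _ , _ , refl , refl , aRb)) = inj₁ aRb
Lex-∷⁻ (inj₂ (_ ∷ r , a , s , b , t , refl , refl , aRb)) =
  inj₂ (refl , inj₂ (r , a , s , b , t , refl , refl , aRb))

¬Lex-[]ʳ : ¬ Lex R x []
¬Lex-[]ʳ {x = x} (inj₁ (t , t≢[] , []≡xt))         = t≢[] (++-conicalʳ x t (sym []≡xt))
¬Lex-[]ʳ (inj₂ ([]    , _ , _ , _ , _ , _ , () , _))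
¬Lex-[]ʳ (inj₂ (_ ∷ _ , _ , _ , _ , _ , _ , () , _))

Lex-asym : Asymmetric R → Asymmetric (Lex R)
Lex-asym asym {[]}    {_}     _ q = ¬Lex-[]ʳ q
Lex-asym asym {_ ∷ _} {[]}    p _ = ¬Lex-[]ʳ p
Lex-asym asym {_ ∷ _} {_ ∷ _} p q with Lex-∷⁻ p | Lex-∷⁻ q
... | inj₁ aRb         | inj₁ bRa         = asym aRb bRa
... | inj₁ aRa         | inj₂ (refl , _)  = asym aRa aRa
... | inj₂ (refl , _)  | inj₁ aRa         = asym aRa aRa
... | inj₂ (refl , p′) | inj₂ (_ , q′)    = Lex-asym asym p′ q′

Lex-++⁻ : Asymmetric R → ∀ z → Lex R (z ++ x) (z ++ y) → Lex R x y
Lex-++⁻ asym []      p = p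
Lex-++⁻ asym (c ∷ z) p with Lex-∷⁻ p
... | inj₁ cRc      = ⊥-elim (asym cRc cRc)
... | inj₂ (_ , p′) = Lex-++⁻ asym z p′

Lex-++-≡length : length x ≡ length y → Lex R (x ++ u) (y ++ v) → Lex R x y ⊎ x ≡ y
Lex-++-≡length {x = []}    {[]}    _  _ = inj₂ refl
Lex-++-≡length {x = a ∷ x} {b ∷ y} eq p with Lex-∷⁻ p
... | inj₁ aRb         = inj₁ (inj₂ ([] , a , x , b , y , refl , refl , aRb))
... | inj₂ (refl , p′) = Sum.map Lex-∷⁺ (cong (a ∷_)) (Lex-++-≡length (suc-injective eq) p′)

<in-asym : Asymmetric (_<in_ {n})
<in-asym = <-asym

_^_ : Word n → ℕ → Word n
x ^ k = concat (replicate k x)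

^-+ : ∀ (x : Word n) i j → x ^ (i + j) ≡ x ^ i ++ x ^ j
^-+ x zero    j = refl
^-+ x (suc i) j = trans (cong (x ++_) (^-+ x i j)) (sym (++-assoc x (x ^ i) (x ^ j)))

CommonRoot : Word n → Word n → Set
CommonRoot z v = ∃ λ x → ∃₂ λ i j → z ≡ x ^ i × v ≡ x ^ j

CommonRoot-sym : CommonRoot z v → CommonRoot v z
CommonRoot-sym (x , i , j , z≡xⁱ , v≡xʲ) = x , j , i , v≡xʲ , z≡xⁱ

CommonRoot-++ : CommonRoot z v → CommonRoot z (z ++ v)
CommonRoot-++ (x , i , j , refl , refl) = x , i , i + j , refl , sym (^-+ x i j)

++-≡⇒comparable : ∀ x u → x ++ y ≡ u ++ v → IsPrefix x u ⊎ IsPrefix u x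
++-≡⇒comparable []      u       _  = inj₁ (u , refl)
++-≡⇒comparable x       []      _  = inj₂ (x , refl)
++-≡⇒comparable (_ ∷ x) (_ ∷ u) eq with ++-≡⇒comparable x u (∷-injectiveʳ eq) | ∷-injectiveˡ eq
... | inj₁ (e , refl) | refl = inj₁ (e , refl)
... | inj₂ (e , refl) | refl = inj₂ (e , refl)

commute⇒CommonRoot : z ++ v ≡ v ++ z → CommonRoot z v
commute⇒CommonRoot {z = z} {v} = go z v (<-wellFounded (length (z ++ v)))
  where
  go : ∀ z v → Acc _<_ (length (z ++ v)) → z ++ v ≡ v ++ z → CommonRoot z v
  go []       v        _        _ = v , 0 , 1 , refl , sym (++-identityʳ v)
  go z@(_ ∷ _) []      _        _ = z , 1 , 0 , sym (++-identityʳ z) , refl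
  go z@(c ∷ z′) v@(_ ∷ _) (acc rs) zv≡vz with ++-≡⇒comparable z v zv≡vz
  ... | inj₁ (e , refl) =
    CommonRoot-++ (go z e (rs (length-<-∷++ c z′ (z ++ e)))
      (++-cancelˡ z (z ++ e) (e ++ z) (trans zv≡vz (++-assoc z e z))))
  ... | inj₂ (e , refl) =
    CommonRoot-sym (CommonRoot-++ (go v e (rs (length-<-++∷ (v ++ e) _))
      (sym (++-cancelˡ v (e ++ v) (v ++ e) (trans (sym (++-assoc v e v)) zv≡vz)))))

commute⇒¬Primitive : z ≢ [] → v ≢ [] → z ++ v ≡ v ++ z → ¬ Primitive (z ++ v)
commute⇒¬Primitive {z = z} {v = v} z≢[] v≢[] zv≡vz prim
  with commute⇒CommonRoot {z = z} {v = v} zv≡vz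
... | x , zero  , _     , refl , _    = z≢[] refl
... | x , _     , zero  , _    , refl = v≢[] refl
... | x , suc i , suc j , refl , refl =
  prim (x , suc i + suc j , +-mono-≤ (s≤s z≤n) (s≤s z≤n) , sym (^-+ x (suc i) (suc j)))

zt≡vz⇒∣t∣≡∣v∣ : z ++ t ≡ v ++ z → length t ≡ length v
zt≡vz⇒∣t∣≡∣v∣ {z = z} {t} {v} zt≡vz = +-cancelˡ-≡ (length z) (length t) (length v) (begin
  length z + length t  ≡⟨ length-++ z ⟨
  length (z ++ t)      ≡⟨ cong length zt≡vz ⟩
  length (v ++ z)      ≡⟨ length-++ v ⟩
  length v + length z  ≡⟨ +-comm (length v) (length z) ⟩
  length z + length v  ∎)
  where open ≡-Reasoning

AntiLyndon⇒Unbordered : AntiLyndon x → Unbordered x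
AntiLyndon⇒Unbordered {x = w} (_ , prim , minimal) (z , z≢[] , (t , t≢[] , w≡zt) , v , w≡vz)
  with ≡-dec _≟F_ (z ++ v) w
... | yes zv≡w = commute⇒¬Primitive z≢[] v≢[] (trans zv≡w w≡vz) (subst Primitive (sym zv≡w) prim)
  where
  v≢[] : v ≢ []
  v≢[] refl = t≢[] (sym (++-cancelˡ z [] t (trans (++-identityʳ z) (trans (sym w≡vz) w≡zt))))
... | no zv≢w = absurd v≼t
  where
  tz≢w : t ++ z ≢ w
  tz≢w tz≡w = zv≢w (trans (cong (z ++_) (sym (++-cancelʳ z t v (trans tz≡w w≡vz)))) (sym w≡zt))
  t≺v : t ≺in v
  t≺v = Lex-++⁻ <in-asym z (subst (_≺in (z ++ v)) w≡zt (minimal v z w≡vz zv≢w))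
  v≼t : v ≺in t ⊎ v ≡ t
  v≼t = Lex-++-≡length (sym (zt≡vz⇒∣t∣≡∣v∣ {z = z} {t} {v} (trans (sym w≡zt) w≡vz)))
          (subst (_≺in (t ++ z)) w≡vz (minimal z t w≡zt tz≢w))
  absurd : ¬ (v ≺in t ⊎ v ≡ t)
  absurd (inj₁ v≺t) = Lex-asym <in-asym t≺v v≺t
  absurd (inj₂ refl) = zv≢w (sym w≡zt)

IsPrefix-++ʳ : IsPrefix z y → IsPrefix z (y ++ u)
IsPrefix-++ʳ {z = z} {u = u} (t , refl) = t ++ u , ++-assoc z t u

≥p-trans : x ≥p y → y ≥p z → x ≥p z
≥p-trans (_ , refl) z≤y = IsPrefix-++ʳ z≤y

++-≢[]ʳ : ∀ (x : Word n) → y ≢ [] → x ++ y ≢ []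
++-≢[]ʳ x y≢[] = y≢[] ∘ ++-conicalʳ x _

NB-snoc : NB y ys → z ≢ [] → Unbordered z → IsPrefix z y → NB (y ++ z) (ys ++ [ z ])
NB-snoc {y = y} {z = z} nb z≢[] z-unbordered (u , y≡zu) =
  nb-bor (++-≢[]ʳ y z≢[]) z≢[] (proper , y , refl) z-unbordered refl nb
  where
  proper : ProperPrefix z (y ++ z)
  proper = u ++ z , ++-≢[]ʳ u z≢[] , trans (cong (_++ z) y≡zu) (++-assoc z u z)

NB-++-prefixes : NB y ys → All (_≢ []) zs → All Unbordered zs → All (y ≥p_) zs →
                 NB (y ++ concat zs) (ys ++ zs)
NB-++-prefixes {y = y} {ys} nb [] [] [] = subst₂ NB (sym (++-identityʳ y)) (sym (++-identityʳ ys)) nb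
NB-++-prefixes {y = y} {ys} {z ∷ zs} nb (z≢[] ∷ nonempty) (z-unb ∷ unbordered) (z≤y ∷ prefixes) =
  subst₂ NB (++-assoc y z (concat zs)) (++-assoc ys [ z ] zs)
    (NB-++-prefixes (NB-snoc nb z≢[] z-unb z≤y) nonempty unbordered (All.map IsPrefix-++ʳ prefixes))

NB-antiLyndonChain : All AntiLyndon (x ∷ ys) → Linked _≥p_ (x ∷ ys) →
                     NB (concat (x ∷ ys)) (x ∷ ys)
NB-antiLyndonChain (x-anti ∷ anti) chain =
  NB-++-prefixes (nb-unb (proj₁ x-anti) (AntiLyndon⇒Unbordered x-anti))
    (All.map proj₁ anti) (All.map AntiLyndon⇒Unbordered anti) (prefixesOfHead chain)
  where
  prefixesOfHead : Linked _≥p_ (x ∷ ys) → All (x ≥p_) ys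
  prefixesOfHead [-]           = []
  prefixesOfHead (x≥y ∷ chain) = Linked⇒All ≥p-trans x≥y chain

NB-groups : All (_≢ []) gs → All AntiLyndon (concat gs) → Linked _≥p_ (concat gs) →
            Pointwise NB (map concat gs) gs
NB-groups {gs = []}          []              _    _     = []
NB-groups {gs = [] ∷ _}      (g≢[] ∷ _)      _    _     = ⊥-elim (g≢[] refl)
NB-groups {gs = (x ∷ g) ∷ _} (_ ∷ nonempty) anti chain =
  NB-antiLyndonChain (All.++⁻ˡ (x ∷ g) anti) (proj₁ split) ∷
  NB-groups nonempty (All.++⁻ʳ (x ∷ g) anti) (proj₂ split)
  where split = Linked-++⁻ (x ∷ g) chain

NB-groupings : All AntiLyndon (concat lss) → All (Linked _≥p_) lss → Pointwise IsGroupingOf lss mss →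
               ∃ λ nbs → Pointwise NB (concat mss) nbs × concat lss ≡ concat nbs
NB-groupings _    []               []  = [] , [] , refl
NB-groupings anti (chain ∷ chains) ((gs , nonempty , refl , refl , _) ∷ groupings)
  with NB-groupings (All.++⁻ʳ (concat gs) anti) chains groupings
... | nbs , nb , lss≡nbs =
  gs ++ nbs ,
  Pointwise.++⁺ (NB-groups nonempty (All.++⁻ˡ (concat gs) anti) chain) nb ,
  trans (cong (concat gs ++_) lss≡nbs) (concat-++ gs nbs)

proposition8p10 : ∀ {n : ℕ} (w : Word n) → w ≢ [] →
    (ℓs : List (Word n)) → IsCFLin w ℓs →
    (ms : List (Word n)) → IsGroupingCFL ℓs ms →
    ∃ λ (nbs : List (List (Word n))) → Pointwise NB ms nbs × ℓs ≡ concat nbs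
proposition8p10 _ _ _ (anti , _ , _) _ (_ , (refl , chains , _) , mss , groupings , refl) =
  NB-groupings anti (All.map⁺ chains) groupings
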